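{- For all integers $a,b,c,d \geq 0$, $i_s(a+c,b+d,0) \geq \binom{a+b}{a} i_s(c,d,0)$ and $i_v(a+c,b+d,0) \geq \binom{a+b}{a} i_v(c,d,0)$.
   Context: $F$ is a fixed infinite field; vector spaces are finite-dimensional over $F$ and within a system are subspaces of a common ambient space. Index sets are finite totally ordered sets. An $(a,b,c)$ modified set system is a sequence $(A_i,B_i)_{i\in I}$ of pairs of finite sets with $|A_i\cap\bigcup_{k<i}A_k|\le a$, $|B_i|\le b$, $|A_i\cap B_i|\le c$ for all $i$, and $|A_i\cap B_j|>c$ for all $i<j$. An $(a,b,c)$ modified vector space system is the analogous notion for subspaces, with dimension in place of cardinality and $\sum$ in place of $\bigcup$. $i_s(a,b,c)$ (resp. $i_v(a,b,c)$) is the maximum of $|I|$ over all $(a,b,c)$ modified set (resp. vector space) systems. -}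

module Defs where

open import Level using (Level; _⊔_; 0ℓ) renaming (suc to lsuc)
open import Data.Nat using (ℕ; zero; suc; _≤_; _<_)
open import Data.Fin using (Fin) renaming (_<_ to _<ᶠ_; _<?_ to _<ᶠ?_)
open import Data.Fin.Subset using (Subset; _∩_; ⋃; ∣_∣)
open import Data.List using (List; []; _∷_; map; filter; concat)
open import Data.List.Relation.Unary.All using (All)
open import Data.Vec using (Vec; []; _∷_; lookup; toList)
open import Data.Vec.Functional using (Vector) renaming (toList to toListF)
open import Data.List using (allFin)
open import Data.Product using (Σ; ∃; _×_; _,_)
open import Relation.Nullary using (¬_)
open import Algebra.Bundles using (CommutativeRing)

record Field (f ℓ : Level) : Set (lsuc (f ⊔ ℓ)) where
  field
    commutativeRing : CommutativeRing f ℓ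
  open CommutativeRing commutativeRing public
  field
    0≉1     : ¬ (0# ≈ 1#)
    inverse : ∀ x → ¬ (x ≈ 0#) → ∃ λ y → (x * y) ≈ 1#

Infinite : ∀ {f ℓ} → Field f ℓ → Set (f ⊔ ℓ)
Infinite F = ∀ (xs : List Carrier) → ∃ λ x → All (λ y → ¬ (x ≈ y)) xs
  where open Field F

before : ∀ {m} → Fin m → List (Fin m)
before {m} i = filter (λ k → k <ᶠ? i) (allFin m)

unionBefore : ∀ {N m} → (Fin m → Subset N) → Fin m → Subset N
unionBefore A i = ⋃ (map A (before i))

IsModSetSystem : ∀ {N m} → ℕ → ℕ → ℕ →
                 (Fin m → Subset N) → (Fin m → Subset N) → Set
IsModSetSystem a b c A B =
    (∀ i → ∣ A i ∩ unionBefore A i ∣ ≤ a)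
  × (∀ i → ∣ B i ∣ ≤ b)
  × (∀ i → ∣ A i ∩ B i ∣ ≤ c)
  × (∀ i j → i <ᶠ j → c < ∣ A i ∩ B j ∣)

HasModSetSystem : ℕ → ℕ → ℕ → ℕ → Set
HasModSetSystem a b c m =
  Σ ℕ λ N → Σ (Fin m → Subset N) λ A → Σ (Fin m → Subset N) λ B →
    IsModSetSystem a b c A B

-- Vector space systems over a field F inside the ambient space F^N.
-- A (finite-dimensional) subspace is given by a finite spanning list.

module VS {f ℓ} (F : Field f ℓ) where
  open Field F

  Vect : ℕ → Set f
  Vect N = Fin N → Carrier

  VPred : ℕ → Set (lsuc (f ⊔ ℓ))
  VPred N = Vect N → Set (f ⊔ ℓ)

  zeroV : ∀ {N} → Vect N
  zeroV _ = 0#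

  _≈V_ : ∀ {N} → Vect N → Vect N → Set ℓ
  u ≈V v = ∀ x → u x ≈ v x

  lincomb : ∀ {N k} → Vec (Vect N) k → Vec Carrier k → Vect N
  lincomb []       []       _ = 0#
  lincomb (v ∷ vs) (l ∷ ls) x = (l * v x) + lincomb vs ls x

  lincombL : ∀ {N} → (vs : List (Vect N)) → Vector Carrier (Data.List.length vs) → Vect N
  lincombL []       ls x = 0#
  lincombL (v ∷ vs) ls x = (ls Fin.zero * v x) + lincombL vs (λ j → ls (Fin.suc j)) x
    where import Data.Fin as Fin

  Subspace : ℕ → Set f
  Subspace N = List (Vect N)

  ⟨_⟩ : ∀ {N} → Subspace N → VPred N
  ⟨ vs ⟩ v = Σ (Vector Carrier (Data.List.length vs)) λ ls → v ≈V lincombL vs ls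

  _∩V_ : ∀ {N} → Subspace N → Subspace N → VPred N
  (U ∩V W) v = ⟨ U ⟩ v × ⟨ W ⟩ v

  LinIndep : ∀ {N k} → Vec (Vect N) k → Set (f ⊔ ℓ)
  LinIndep {k = k} vs =
    ∀ (ls : Vec Carrier k) → lincomb vs ls ≈V zeroV → ∀ j → lookup ls j ≈ 0#

  DimLe : ∀ {N} → VPred N → ℕ → Set (f ⊔ ℓ)
  DimLe {N} P a = ∀ k (vs : Vec (Vect N) k) →
    (∀ j → P (lookup vs j)) → LinIndep vs → k ≤ a

  DimGt : ∀ {N} → VPred N → ℕ → Set (f ⊔ ℓ)
  DimGt {N} P c = Σ (Vec (Vect N) (suc c)) λ vs →
    (∀ j → P (lookup vs j)) × LinIndep vs

  sumBefore : ∀ {N m} → (Fin m → Subspace N) → Fin m → Subspace N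
  sumBefore A i = concat (map A (before i))

  IsModVecSystem : ∀ {N m} → ℕ → ℕ → ℕ →
                   (Fin m → Subspace N) → (Fin m → Subspace N) → Set (f ⊔ ℓ)
  IsModVecSystem a b c A B =
      (∀ i → DimLe (A i ∩V sumBefore A i) a)
    × (∀ i → DimLe ⟨ B i ⟩ b)
    × (∀ i → DimLe (A i ∩V B i) c)
    × (∀ i j → i <ᶠ j → DimGt (A i ∩V B j) c)

  HasModVecSystem : ℕ → ℕ → ℕ → ℕ → Set (f ⊔ ℓ)
  HasModVecSystem a b c m =
    Σ ℕ λ N → Σ (Fin m → Subspace N) λ A → Σ (Fin m → Subspace N) λ B →
      IsModVecSystem a b c A B

module Submission where

-- Both inequalities come from one merging step and Pascal's rule. Given a (p, q+1, 0)
-- system (A₁, B₁) and a (p+1, q, 0) system (A₂, B₂) on disjoint ground sets, add a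
-- fresh point x and list the pairs (A₁ᵢ ∪ {x}, B₁ᵢ) followed by the pairs
-- (A₂ⱼ, B₂ⱼ ∪ {x}). The point x raises the bounds on |Aᵢ ∩ ⋃ earlier A| and on |Bᵢ| by
-- at most one, never lies in a diagonal intersection Aᵢ ∩ Bᵢ, and lies in every
-- A₁ᵢ ∩ B₂ⱼ, which is exactly the condition across the two blocks. Hence
-- i(p+1, q+1, 0) ≥ i(p, q+1, 0) + i(p+1, q, 0), and induction on a + b, using
-- monotonicity in the first two parameters when a = 0 or b = 0, multiplies
-- i(c, d, 0) by (a+b choose a). For subspaces the same construction lives in
-- F ⊕ F^N₁ ⊕ F^N₂, with x replaced by the new basis vector e₀; dimensions are bounded
-- by restricting to one block, after cutting out e₀ by the hyperplane of its
-- coordinate where e₀ occurs.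

open import Defs
open import Level using (Level)

module Amplification where

  open import Data.Nat using (ℕ; zero; suc; _+_; _*_; _≤_)
  open import Data.Nat.Combinatorics using (_C_; nCn≡1; nCk+nC[k+1]≡[n+1]C[k+1])
  open import Data.Nat.Properties using (≤-refl; m≤n+m; +-identityʳ; +-suc; *-identityˡ; *-distribʳ-+)
  open import Relation.Binary.PropositionalEquality using (_≡_; refl; sym; cong; subst; module ≡-Reasoning)

  nC0≡1 : ∀ n → n C 0 ≡ 1
  nC0≡1 zero    = refl
  nC0≡1 (suc n) = refl

  module _ {ℓ} (Sys : ℕ → ℕ → ℕ → Set ℓ)
    (mono : ∀ {p q p′ q′ m} → p ≤ p′ → q ≤ q′ → Sys p q m → Sys p′ q′ m)
    (merge : ∀ {p q m₁ m₂} → Sys p (suc q) m₁ → Sys (suc p) q m₂ → Sys (suc p) (suc q) (m₁ + m₂))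
    where

    binomial-amplify : ∀ a b {c d m} → Sys c d m → Sys (a + c) (b + d) (((a + b) C a) * m)
    binomial-amplify zero b {c} {d} {m} s = subst (Sys c (b + d)) eq (mono ≤-refl (m≤n+m d b) s)
      where
      eq : m ≡ (b C 0) * m
      eq rewrite nC0≡1 b = sym (*-identityˡ m)
    binomial-amplify (suc a) zero {c} {d} {m} s = subst (Sys (suc a + c) d) eq (mono (m≤n+m c (suc a)) ≤-refl s)
      where
      eq : m ≡ ((suc a + 0) C suc a) * m
      eq rewrite +-identityʳ a | nCn≡1 (suc a) = sym (*-identityˡ m)
    binomial-amplify (suc a) (suc b) {c} {d} {m} s =
      subst (Sys (suc a + c) (suc b + d)) pascal
        (merge (binomial-amplify a (suc b) s) (binomial-amplify (suc a) b s))
      where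
      open ≡-Reasoning
      n = a + suc b
      pascal : (n C a) * m + ((suc a + b) C suc a) * m ≡ (suc n C suc a) * m
      pascal = begin
        (n C a) * m + ((suc a + b) C suc a) * m ≡⟨ cong (λ t → (n C a) * m + (t C suc a) * m) (sym (+-suc a b)) ⟩
        (n C a) * m + (n C suc a) * m           ≡⟨ sym (*-distribʳ-+ m (n C a) (n C suc a)) ⟩
        (n C a + n C suc a) * m                 ≡⟨ cong (_* m) (nCk+nC[k+1]≡[n+1]C[k+1] n a) ⟩
        (suc n C suc a) * m                     ∎

module Indexing where

  open import Data.Nat using (ℕ; _+_)
  open import Data.Nat.Properties using (+-cancelˡ-<; <-≤-trans; m≤m+n; <-asym)
  open import Data.Fin using (Fin; toℕ; _↑ˡ_; _↑ʳ_; splitAt) renaming (_<_ to _<ᶠ_; _<?_ to _<ᶠ?_)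
  open import Data.Fin.Properties using (splitAt-↑ˡ; splitAt-↑ʳ; splitAt⁻¹-↑ˡ; splitAt⁻¹-↑ʳ; toℕ-↑ˡ; toℕ-↑ʳ; toℕ<n)
  open import Data.Sum using (inj₁; inj₂; [_,_]′)
  open import Data.Product using (proj₂)
  open import Data.List using (List; map; concat; allFin)
  open import Data.List.Membership.Propositional using (_∈_)
  open import Data.List.Membership.Propositional.Properties using (∈-filter⁺; ∈-filter⁻; ∈-allFin; ∈-concat⁺′; ∈-map⁺)
  open import Data.List.Relation.Unary.All using (All; tabulate)
  open import Data.List.Relation.Unary.All.Properties using (map⁺; concat⁺)
  open import Function using (_∘_)
  open import Relation.Binary.PropositionalEquality using (_≡_; refl; sym; subst; subst₂)
  open import Relation.Nullary using (¬_)

  ∈-before⁻ : ∀ {m} {k k′ : Fin m} → k′ ∈ before k → k′ <ᶠ k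
  ∈-before⁻ {m} {k} k′∈ = proj₂ (∈-filter⁻ (_<ᶠ? k) {xs = allFin m} k′∈)

  ∈-before⁺ : ∀ {m} {k k′ : Fin m} → k′ <ᶠ k → k′ ∈ before k
  ∈-before⁺ {k = k} {k′} k′<k = ∈-filter⁺ (_<ᶠ? k) (∈-allFin k′) k′<k

  module _ {a} {X : Set a} {m} (A : Fin m → List X) where

    ∈-concat-before : ∀ {k k′ x} → k′ <ᶠ k → x ∈ A k′ → x ∈ concat (map A (before k))
    ∈-concat-before k′<k x∈ = ∈-concat⁺′ x∈ (∈-map⁺ A (∈-before⁺ k′<k))

    All-concat-before : ∀ {p} {P : X → Set p} k → (∀ k′ → k′ <ᶠ k → All P (A k′)) →
                        All P (concat (map A (before k)))
    All-concat-before k h = concat⁺ (map⁺ (tabulate (λ k′∈ → h _ (∈-before⁻ k′∈))))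

  module Blocks (m₁ m₂ : ℕ) where

    glue : ∀ {a} {X : Set a} → (Fin m₁ → X) → (Fin m₂ → X) → Fin (m₁ + m₂) → X
    glue f g = [ f , g ]′ ∘ splitAt m₁

    glue-↑ˡ : ∀ {a} {X : Set a} (f : Fin m₁ → X) (g : Fin m₂ → X) i → glue f g (i ↑ˡ m₂) ≡ f i
    glue-↑ˡ f g i rewrite splitAt-↑ˡ m₁ i m₂ = refl

    glue-↑ʳ : ∀ {a} {X : Set a} (f : Fin m₁ → X) (g : Fin m₂ → X) j → glue f g (m₁ ↑ʳ j) ≡ g j
    glue-↑ʳ f g j rewrite splitAt-↑ʳ m₁ m₂ j = refl

    data Block : Fin (m₁ + m₂) → Set where
      left  : (i : Fin m₁) → Block (i ↑ˡ m₂)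
      right : (j : Fin m₂) → Block (m₁ ↑ʳ j)

    block : ∀ k → Block k
    block k with splitAt m₁ k in eq
    ... | inj₁ i = subst Block (splitAt⁻¹-↑ˡ eq) (left i)
    ... | inj₂ j = subst Block (splitAt⁻¹-↑ʳ eq) (right j)

    glue-elim : ∀ {a p} {X : Set a} (P : Fin (m₁ + m₂) → X → Set p) {f g} →
      (∀ i → P (i ↑ˡ m₂) (f i)) → (∀ j → P (m₁ ↑ʳ j) (g j)) → ∀ k → P k (glue f g k)
    glue-elim P {f} {g} Pf Pg k with block k
    ... | left i  = subst (P _) (sym (glue-↑ˡ f g i)) (Pf i)
    ... | right j = subst (P _) (sym (glue-↑ʳ f g j)) (Pg j)

    glue-elim₂ : ∀ {a b p} {X : Set a} {Y : Set b} (P : Fin (m₁ + m₂) → X → Y → Set p) {f g f′ g′} →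
      (∀ i → P (i ↑ˡ m₂) (f i) (f′ i)) → (∀ j → P (m₁ ↑ʳ j) (g j) (g′ j)) →
      ∀ k → P k (glue f g k) (glue f′ g′ k)
    glue-elim₂ P {f} {g} {f′} {g′} Pf Pg k with block k
    ... | left i  = subst₂ (P _) (sym (glue-↑ˡ f g i)) (sym (glue-↑ˡ f′ g′ i)) (Pf i)
    ... | right j = subst₂ (P _) (sym (glue-↑ʳ f g j)) (sym (glue-↑ʳ f′ g′ j)) (Pg j)

    ↑ˡ-<-cancel : ∀ {i i′ : Fin m₁} → i ↑ˡ m₂ <ᶠ i′ ↑ˡ m₂ → i <ᶠ i′
    ↑ˡ-<-cancel {i} {i′} lt rewrite toℕ-↑ˡ i m₂ | toℕ-↑ˡ i′ m₂ = lt

    ↑ʳ-<-cancel : ∀ {j j′ : Fin m₂} → m₁ ↑ʳ j <ᶠ m₁ ↑ʳ j′ → j <ᶠ j′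
    ↑ʳ-<-cancel {j} {j′} lt rewrite toℕ-↑ʳ m₁ j | toℕ-↑ʳ m₁ j′ = +-cancelˡ-< m₁ (toℕ j) (toℕ j′) lt

    ↑ˡ<↑ʳ : ∀ {i : Fin m₁} {j : Fin m₂} → i ↑ˡ m₂ <ᶠ m₁ ↑ʳ j
    ↑ˡ<↑ʳ {i} {j} rewrite toℕ-↑ˡ i m₂ | toℕ-↑ʳ m₁ j = <-≤-trans (toℕ<n i) (m≤m+n m₁ (toℕ j))

    ↑ʳ≮↑ˡ : ∀ {i : Fin m₁} {j : Fin m₂} → ¬ (m₁ ↑ʳ j <ᶠ i ↑ˡ m₂)
    ↑ʳ≮↑ˡ lt = <-asym lt ↑ˡ<↑ʳ

module SetSystems where

  open import Data.Nat using (ℕ; suc; _+_; _≤_; _<_; z≤n; s≤s)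
  open Indexing
  open import Data.Nat.Properties using (≤-trans; +-identityʳ; m≤m+n; module ≤-Reasoning)
  open import Data.Bool using (_∧_)
  open import Data.Fin using (Fin; _↑ˡ_; _↑ʳ_) renaming (_<_ to _<ᶠ_)
  open import Data.Fin.Subset using (Subset; _∩_; ⋃; ∣_∣; ⊥; ⊤; _⊆_; inside; outside)
  open import Data.Fin.Subset.Properties
    using (x∈p∩q⁺; x∈p∩q⁻; x∈p∪q⁻; p⊆p∪q; q⊆p∪q; ⊥⊆; ⊆⊤; ∣⊥∣≡0; p⊆q⇒∣p∣≤∣q∣; ∩-zeroˡ; drop-∷-⊆; in⊆in; out⊆)
  open import Data.Vec using ([]; _∷_; _++_; here; there)
  open import Data.List using (List; []; _∷_; map)
  open import Data.List.Membership.Propositional using (_∈_)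
  open import Data.List.Membership.Propositional.Properties using (∈-map⁺)
  open import Data.List.Relation.Unary.All using (All; []; _∷_; tabulate)
  open import Data.List.Relation.Unary.All.Properties using (map⁺)
  import Data.List.Relation.Unary.Any as Any
  open import Data.Product using (_,_; proj₁; proj₂)
  open import Data.Sum using (inj₁; inj₂)
  open import Data.Empty using (⊥-elim)
  open import Relation.Binary.PropositionalEquality using (_≡_; refl; sym; trans; cong; cong₂; subst)

  ∣∷∣ : ∀ {n} x (s : Subset n) → ∣ x ∷ s ∣ ≡ ∣ x ∷ [] ∣ + ∣ s ∣
  ∣∷∣ inside  s = refl
  ∣∷∣ outside s = refl

  ∣++∣ : ∀ {n₁ n₂} (s : Subset n₁) (t : Subset n₂) → ∣ s ++ t ∣ ≡ ∣ s ∣ + ∣ t ∣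
  ∣++∣ []            t = refl
  ∣++∣ (inside ∷ s)  t = cong suc (∣++∣ s t)
  ∣++∣ (outside ∷ s) t = ∣++∣ s t

  ++-∩ : ∀ {n₁ n₂} (s s′ : Subset n₁) (t t′ : Subset n₂) → (s ++ t) ∩ (s′ ++ t′) ≡ (s ∩ s′) ++ (t ∩ t′)
  ++-∩ []      []        t t′ = refl
  ++-∩ (x ∷ s) (x′ ∷ s′) t t′ = cong (x ∧ x′ ∷_) (++-∩ s s′ t t′)

  ∣∷++∩∷++∣ : ∀ {n₁ n₂} x x′ (s s′ : Subset n₁) (t t′ : Subset n₂) →
    ∣ (x ∷ s ++ t) ∩ (x′ ∷ s′ ++ t′) ∣ ≡ ∣ x ∧ x′ ∷ [] ∣ + (∣ s ∩ s′ ∣ + ∣ t ∩ t′ ∣)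
  ∣∷++∩∷++∣ x x′ s s′ t t′ =
    trans (∣∷∣ (x ∧ x′) ((s ++ t) ∩ (s′ ++ t′)))
          (cong (∣ x ∧ x′ ∷ [] ∣ +_) (trans (cong ∣_∣ (++-∩ s s′ t t′)) (∣++∣ (s ∩ s′) (t ∩ t′))))

  ∣⊥∩∣≡0 : ∀ {n} (s : Subset n) → ∣ ⊥ ∩ s ∣ ≡ 0
  ∣⊥∩∣≡0 {n} s rewrite ∩-zeroˡ s = ∣⊥∣≡0 n

  ++-mono-⊆ : ∀ {n₁ n₂} {s s′ : Subset n₁} {t t′ : Subset n₂} → s ⊆ s′ → t ⊆ t′ → s ++ t ⊆ s′ ++ t′
  ++-mono-⊆ {s = []}    {[]}     _  t⊆ x∈         = t⊆ x∈
  ++-mono-⊆ {s = _ ∷ _} {_ ∷ _} s⊆ t⊆ here with s⊆ here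
  ... | here = here
  ++-mono-⊆ {s = _ ∷ _} {_ ∷ _} s⊆ t⊆ (there x∈) = there (++-mono-⊆ (drop-∷-⊆ s⊆) t⊆ x∈)

  ∩-monoʳ-⊆ : ∀ {n} (s : Subset n) {t t′} → t ⊆ t′ → s ∩ t ⊆ s ∩ t′
  ∩-monoʳ-⊆ s {t} t⊆ x∈ = let (x∈s , x∈t) = x∈p∩q⁻ s t x∈ in x∈p∩q⁺ (x∈s , t⊆ x∈t)

  ⋃-least : ∀ {n} {t : Subset n} (ss : List (Subset n)) → All (_⊆ t) ss → ⋃ ss ⊆ t
  ⋃-least []       []         x∈ = ⊥⊆ x∈
  ⋃-least (s ∷ ss) (s⊆ ∷ ss⊆) x∈ with x∈p∪q⁻ s (⋃ ss) x∈
  ... | inj₁ x∈s  = s⊆ x∈s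
  ... | inj₂ x∈ss = ⋃-least ss ss⊆ x∈ss

  ⊆-⋃ : ∀ {n} {s : Subset n} {ss : List (Subset n)} → s ∈ ss → s ⊆ ⋃ ss
  ⊆-⋃ {ss = s ∷ ss} (Any.here refl) = p⊆p∪q (⋃ ss)
  ⊆-⋃ {ss = s ∷ ss} (Any.there s∈) x∈ = q⊆p∪q s (⋃ ss) (⊆-⋃ s∈ x∈)

  module _ {N m} (A : Fin m → Subset N) where

    unionBefore-least : ∀ k {t} → (∀ k′ → k′ <ᶠ k → A k′ ⊆ t) → unionBefore A k ⊆ t
    unionBefore-least k h = ⋃-least (map A (before k)) (map⁺ (tabulate (λ k′∈ → h _ (∈-before⁻ k′∈))))

    ⊆-unionBefore : ∀ {k k′} → k′ <ᶠ k → A k′ ⊆ unionBefore A k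
    ⊆-unionBefore k′<k = ⊆-⋃ (∈-map⁺ A (∈-before⁺ k′<k))

  HasModSetSystem-mono : ∀ {p q p′ q′ m} → p ≤ p′ → q ≤ q′ →
                         HasModSetSystem p q 0 m → HasModSetSystem p′ q′ 0 m
  HasModSetSystem-mono p≤ q≤ (N , A , B , earlier , small , disjoint , meets) =
    N , A , B , (λ i → ≤-trans (earlier i) p≤) , (λ i → ≤-trans (small i) q≤) , disjoint , meets

  module Merge {p q m₁ m₂ N₁ N₂} (A₁ B₁ : Fin m₁ → Subset N₁) (A₂ B₂ : Fin m₂ → Subset N₂)
    (S₁ : IsModSetSystem p (suc q) 0 A₁ B₁) (S₂ : IsModSetSystem (suc p) q 0 A₂ B₂) where

    open Blocks m₁ m₂
    open ≤-Reasoning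

    N : ℕ
    N = suc (N₁ + N₂)

    ⊥₁ ⊤₁ : Subset N₁
    ⊥₁ = ⊥
    ⊤₁ = ⊤

    ⊥₂ ⊤₂ : Subset N₂
    ⊥₂ = ⊥
    ⊤₂ = ⊤

    A₁′ B₁′ : Fin m₁ → Subset N
    A₁′ i = inside  ∷ (A₁ i ++ ⊥₂)
    B₁′ i = outside ∷ (B₁ i ++ ⊥₂)

    A₂′ B₂′ : Fin m₂ → Subset N
    A₂′ j = outside ∷ (⊥₁ ++ A₂ j)
    B₂′ j = inside  ∷ (⊥₁ ++ B₂ j)

    A B : Fin (m₁ + m₂) → Subset N
    A = glue A₁′ A₂′
    B = glue B₁′ B₂′

    earlier-first : ∀ i → unionBefore A (i ↑ˡ m₂) ⊆ inside ∷ (unionBefore A₁ i ++ ⊤₂)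
    earlier-first i = unionBefore-least A (i ↑ˡ m₂) bound
      where
      bound : ∀ k′ → k′ <ᶠ i ↑ˡ m₂ → A k′ ⊆ inside ∷ (unionBefore A₁ i ++ ⊤₂)
      bound k′ lt with block k′
      ... | left i′  = subst (_⊆ _) (sym (glue-↑ˡ A₁′ A₂′ i′))
                         (in⊆in (++-mono-⊆ (⊆-unionBefore A₁ (↑ˡ-<-cancel lt)) ⊆⊤))
      ... | right j′ = ⊥-elim (↑ʳ≮↑ˡ lt)

    earlier-second : ∀ j → unionBefore A (m₁ ↑ʳ j) ⊆ inside ∷ (⊤₁ ++ unionBefore A₂ j)
    earlier-second j = unionBefore-least A (m₁ ↑ʳ j) bound
      where
      bound : ∀ k′ → k′ <ᶠ m₁ ↑ʳ j → A k′ ⊆ inside ∷ (⊤₁ ++ unionBefore A₂ j)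
      bound k′ lt with block k′
      ... | left i′  = subst (_⊆ _) (sym (glue-↑ˡ A₁′ A₂′ i′)) (in⊆in (++-mono-⊆ {s = A₁ i′} ⊆⊤ ⊥⊆))
      ... | right j′ = subst (_⊆ _) (sym (glue-↑ʳ A₁′ A₂′ j′))
                         (out⊆ (++-mono-⊆ ⊆⊤ (⊆-unionBefore A₂ (↑ʳ-<-cancel lt))))

    A∩earlier : ∀ k → ∣ A k ∩ unionBefore A k ∣ ≤ suc p
    A∩earlier = glue-elim (λ k X → ∣ X ∩ unionBefore A k ∣ ≤ suc p) first-bound second-bound
      where
      first-bound : ∀ i → ∣ A₁′ i ∩ unionBefore A (i ↑ˡ m₂) ∣ ≤ suc p
      first-bound i = begin
        ∣ A₁′ i ∩ unionBefore A (i ↑ˡ m₂) ∣            ≤⟨ p⊆q⇒∣p∣≤∣q∣ (∩-monoʳ-⊆ (A₁′ i) (earlier-first i)) ⟩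
        ∣ A₁′ i ∩ (inside ∷ (unionBefore A₁ i ++ ⊤₂)) ∣ ≡⟨ ∣∷++∩∷++∣ inside inside (A₁ i) (unionBefore A₁ i) ⊥₂ ⊤₂ ⟩
        suc (∣ A₁ i ∩ unionBefore A₁ i ∣ + ∣ ⊥₂ ∩ ⊤₂ ∣) ≡⟨ cong (λ z → suc (∣ A₁ i ∩ _ ∣ + z)) (∣⊥∩∣≡0 ⊤₂) ⟩
        suc (∣ A₁ i ∩ unionBefore A₁ i ∣ + 0)           ≡⟨ cong suc (+-identityʳ _) ⟩
        suc ∣ A₁ i ∩ unionBefore A₁ i ∣                 ≤⟨ s≤s (proj₁ S₁ i) ⟩
        suc p                                           ∎
      second-bound : ∀ j → ∣ A₂′ j ∩ unionBefore A (m₁ ↑ʳ j) ∣ ≤ suc p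
      second-bound j = begin
        ∣ A₂′ j ∩ unionBefore A (m₁ ↑ʳ j) ∣             ≤⟨ p⊆q⇒∣p∣≤∣q∣ (∩-monoʳ-⊆ (A₂′ j) (earlier-second j)) ⟩
        ∣ A₂′ j ∩ (inside ∷ (⊤₁ ++ unionBefore A₂ j)) ∣ ≡⟨ ∣∷++∩∷++∣ outside inside ⊥₁ ⊤₁ (A₂ j) (unionBefore A₂ j) ⟩
        ∣ ⊥₁ ∩ ⊤₁ ∣ + ∣ A₂ j ∩ unionBefore A₂ j ∣        ≡⟨ cong (_+ ∣ A₂ j ∩ _ ∣) (∣⊥∩∣≡0 ⊤₁) ⟩
        ∣ A₂ j ∩ unionBefore A₂ j ∣                      ≤⟨ proj₁ S₂ j ⟩
        suc p                                            ∎

    B-small : ∀ k → ∣ B k ∣ ≤ suc q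
    B-small = glue-elim (λ _ X → ∣ X ∣ ≤ suc q) first-bound second-bound
      where
      first-bound : ∀ i → ∣ B₁′ i ∣ ≤ suc q
      first-bound i = begin
        ∣ B₁ i ++ ⊥₂ ∣      ≡⟨ ∣++∣ (B₁ i) ⊥₂ ⟩
        ∣ B₁ i ∣ + ∣ ⊥₂ ∣   ≡⟨ cong (∣ B₁ i ∣ +_) (∣⊥∣≡0 N₂) ⟩
        ∣ B₁ i ∣ + 0        ≡⟨ +-identityʳ _ ⟩
        ∣ B₁ i ∣            ≤⟨ proj₁ (proj₂ S₁) i ⟩
        suc q               ∎
      second-bound : ∀ j → ∣ B₂′ j ∣ ≤ suc q
      second-bound j = begin
        suc ∣ ⊥₁ ++ B₂ j ∣        ≡⟨ cong suc (∣++∣ ⊥₁ (B₂ j)) ⟩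
        suc (∣ ⊥₁ ∣ + ∣ B₂ j ∣)   ≡⟨ cong (λ z → suc (z + ∣ B₂ j ∣)) (∣⊥∣≡0 N₁) ⟩
        suc ∣ B₂ j ∣              ≤⟨ s≤s (proj₁ (proj₂ S₂) j) ⟩
        suc q                     ∎

    A∩B-empty : ∀ k → ∣ A k ∩ B k ∣ ≤ 0
    A∩B-empty = glue-elim₂ (λ _ X Y → ∣ X ∩ Y ∣ ≤ 0) first-bound second-bound
      where
      first-bound : ∀ i → ∣ A₁′ i ∩ B₁′ i ∣ ≤ 0
      first-bound i = begin
        ∣ A₁′ i ∩ B₁′ i ∣               ≡⟨ ∣∷++∩∷++∣ inside outside (A₁ i) (B₁ i) ⊥₂ ⊥₂ ⟩
        ∣ A₁ i ∩ B₁ i ∣ + ∣ ⊥₂ ∩ ⊥₂ ∣   ≡⟨ cong (∣ A₁ i ∩ B₁ i ∣ +_) (∣⊥∩∣≡0 ⊥₂) ⟩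
        ∣ A₁ i ∩ B₁ i ∣ + 0             ≡⟨ +-identityʳ _ ⟩
        ∣ A₁ i ∩ B₁ i ∣                 ≤⟨ proj₁ (proj₂ (proj₂ S₁)) i ⟩
        0                               ∎
      second-bound : ∀ j → ∣ A₂′ j ∩ B₂′ j ∣ ≤ 0
      second-bound j = begin
        ∣ A₂′ j ∩ B₂′ j ∣               ≡⟨ ∣∷++∩∷++∣ outside inside ⊥₁ ⊥₁ (A₂ j) (B₂ j) ⟩
        ∣ ⊥₁ ∩ ⊥₁ ∣ + ∣ A₂ j ∩ B₂ j ∣   ≡⟨ cong (_+ ∣ A₂ j ∩ B₂ j ∣) (∣⊥∩∣≡0 ⊥₁) ⟩
        ∣ A₂ j ∩ B₂ j ∣                 ≤⟨ proj₁ (proj₂ (proj₂ S₂)) j ⟩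
        0                               ∎

    A∩later-B : ∀ k k′ → k <ᶠ k′ → 0 < ∣ A k ∩ B k′ ∣
    A∩later-B k k′ lt with block k | block k′
    ... | left i | left i′ = begin-strict
      0                                 <⟨ proj₂ (proj₂ (proj₂ S₁)) i i′ (↑ˡ-<-cancel lt) ⟩
      ∣ A₁ i ∩ B₁ i′ ∣                  ≤⟨ m≤m+n _ _ ⟩
      ∣ A₁ i ∩ B₁ i′ ∣ + ∣ ⊥₂ ∩ ⊥₂ ∣      ≡⟨ sym (∣∷++∩∷++∣ inside outside (A₁ i) (B₁ i′) ⊥₂ ⊥₂) ⟩
      ∣ A₁′ i ∩ B₁′ i′ ∣                ≡⟨ sym (cong₂ (λ X Y → ∣ X ∩ Y ∣) (glue-↑ˡ A₁′ A₂′ i) (glue-↑ˡ B₁′ B₂′ i′)) ⟩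
      ∣ A (i ↑ˡ m₂) ∩ B (i′ ↑ˡ m₂) ∣    ∎
    ... | left i | right j′ = begin-strict
      0                                      <⟨ s≤s z≤n ⟩
      suc (∣ A₁ i ∩ ⊥₁ ∣ + ∣ ⊥₂ ∩ B₂ j′ ∣)    ≡⟨ sym (∣∷++∩∷++∣ inside inside (A₁ i) ⊥₁ ⊥₂ (B₂ j′)) ⟩
      ∣ A₁′ i ∩ B₂′ j′ ∣                     ≡⟨ sym (cong₂ (λ X Y → ∣ X ∩ Y ∣) (glue-↑ˡ A₁′ A₂′ i) (glue-↑ʳ B₁′ B₂′ j′)) ⟩
      ∣ A (i ↑ˡ m₂) ∩ B (m₁ ↑ʳ j′) ∣         ∎
    ... | right j | left i′ = ⊥-elim (↑ʳ≮↑ˡ lt)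
    ... | right j | right j′ = begin-strict
      0                                 <⟨ proj₂ (proj₂ (proj₂ S₂)) j j′ (↑ʳ-<-cancel lt) ⟩
      ∣ A₂ j ∩ B₂ j′ ∣                  ≡⟨ cong (_+ ∣ A₂ j ∩ B₂ j′ ∣) (sym (∣⊥∩∣≡0 ⊥₁)) ⟩
      ∣ ⊥₁ ∩ ⊥₁ ∣ + ∣ A₂ j ∩ B₂ j′ ∣      ≡⟨ sym (∣∷++∩∷++∣ outside inside ⊥₁ ⊥₁ (A₂ j) (B₂ j′)) ⟩
      ∣ A₂′ j ∩ B₂′ j′ ∣                ≡⟨ sym (cong₂ (λ X Y → ∣ X ∩ Y ∣) (glue-↑ʳ A₁′ A₂′ j) (glue-↑ʳ B₁′ B₂′ j′)) ⟩
      ∣ A (m₁ ↑ʳ j) ∩ B (m₁ ↑ʳ j′) ∣    ∎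

    isModSetSystem : IsModSetSystem (suc p) (suc q) 0 A B
    isModSetSystem = A∩earlier , B-small , A∩B-empty , A∩later-B

  merge : ∀ {p q m₁ m₂} → HasModSetSystem p (suc q) 0 m₁ → HasModSetSystem (suc p) q 0 m₂ →
          HasModSetSystem (suc p) (suc q) 0 (m₁ + m₂)
  merge (_ , A₁ , B₁ , S₁) (_ , A₂ , B₂ , S₂) = N , A , B , isModSetSystem
    where open Merge A₁ B₁ A₂ B₂ S₁ S₂

module Linear {f ℓ} (F : Field f ℓ) where

  open import Level using (_⊔_)
  open import Data.Nat using (zero; suc; _≤_; _≤?_; z≤n; s≤s)
  open import Data.Nat.Properties using (m≤n⇒m≤1+n)
  open import Data.Fin using (Fin; zero; suc; punchIn)
  open import Data.Maybe using (Maybe; just; nothing; maybe′)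
  open import Data.Vec using (Vec; []; _∷_; lookup; map; insertAt; removeAt)
  open import Data.Vec.Properties using (lookup-map; insertAt-punchIn)
  open import Data.List using (List; []; _∷_; length)
  open import Data.List.Membership.Propositional using (_∈_)
  open import Data.List.Relation.Unary.All using (All; []; _∷_; tabulate)
  open import Data.List.Relation.Unary.Any using (here; there)
  open import Data.Product using (Σ; ∃; _×_; _,_; proj₁; proj₂)
  open import Data.Sum using (_⊎_; inj₁; inj₂)
  open import Data.Empty using (⊥)
  open import Function using (_∘_)
  open import Relation.Nullary using (¬_; Dec; yes; no)
  open import Relation.Nullary.Decidable using (decidable-stable; ¬¬-excluded-middle)
  import Relation.Binary.PropositionalEquality as ≡

  open Field F hiding (zero)
  open VS F
  open import Algebra.Solver.Ring.NaturalCoefficients.Default commutativeSemiring using (solve; _:+_; _:*_; _:=_)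
  open import Algebra.Properties.Ring ring using (-‿distribˡ-*)

  addMul : ∀ {M} → Vect M → Carrier → Vect M → Vect M
  addMul u μ w y = u y + μ * w y

  AddMulClosed : ∀ {M} → VPred M → Set (f ⊔ ℓ)
  AddMulClosed {M} P = ∀ {u w : Vect M} μ → P u → P w → P (addMul u μ w)

  lincombL-zero : ∀ {M} (L : List (Vect M)) y → lincombL L (λ _ → 0#) y ≈ 0#
  lincombL-zero []      y = refl
  lincombL-zero (v ∷ L) y = trans (+-cong (zeroˡ (v y)) (lincombL-zero L y)) (+-identityˡ 0#)

  ⟨⟩-zeroV : ∀ {M} (L : List (Vect M)) → ⟨ L ⟩ zeroV
  ⟨⟩-zeroV L = (λ _ → 0#) , λ y → sym (lincombL-zero L y)

  ⟨⟩-resp-≈V : ∀ {M} {L : List (Vect M)} {u v} → u ≈V v → ⟨ L ⟩ v → ⟨ L ⟩ u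
  ⟨⟩-resp-≈V u≈v (ls , v≈) = ls , λ y → trans (u≈v y) (v≈ y)

  ⟨⟩-∈ : ∀ {M} {L : List (Vect M)} {u} → u ∈ L → ⟨ L ⟩ u
  ⟨⟩-∈ {L = u ∷ L} (here ≡.refl) = ls , λ y → sym (trans (+-cong (*-identityˡ (u y)) (lincombL-zero L y)) (+-identityʳ (u y)))
    where
    ls : Fin (suc (length L)) → Carrier
    ls zero    = 1#
    ls (suc _) = 0#
  ⟨⟩-∈ {L = v ∷ L} (there u∈) with ⟨⟩-∈ u∈
  ... | ls , u≈ = ls′ , λ y → trans (u≈ y) (sym (trans (+-cong (zeroˡ (v y)) refl) (+-identityˡ _)))
    where
    ls′ : Fin (suc (length L)) → Carrier
    ls′ zero    = 0#
    ls′ (suc j) = ls j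

  lincombL-addMul : ∀ {M} (L : List (Vect M)) ls ls′ μ y →
    lincombL L ls y + μ * lincombL L ls′ y ≈ lincombL L (λ t → ls t + μ * ls′ t) y
  lincombL-addMul []      ls ls′ μ y = trans (+-identityˡ _) (zeroʳ μ)
  lincombL-addMul (v ∷ L) ls ls′ μ y =
    trans (regroup (ls zero) (ls′ zero) μ (v y) _ _)
          (+-cong refl (lincombL-addMul L (ls ∘ suc) (ls′ ∘ suc) μ y))
    where
    regroup : ∀ a b μ x r r′ → (a * x + r) + μ * (b * x + r′) ≈ (a + μ * b) * x + (r + μ * r′)
    regroup = solve 6 (λ a b μ x r r′ → (a :* x :+ r) :+ μ :* (b :* x :+ r′) := (a :+ μ :* b) :* x :+ (r :+ μ :* r′)) refl

  ⟨⟩-addMul-closed : ∀ {M} {L : List (Vect M)} → AddMulClosed ⟨ L ⟩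
  ⟨⟩-addMul-closed {L = L} μ (ls , u≈) (ls′ , w≈) =
    (λ t → ls t + μ * ls′ t) , λ y → trans (+-cong (u≈ y) (*-congˡ (w≈ y))) (lincombL-addMul L ls ls′ μ y)

  ∩V-addMul-closed : ∀ {M} {U W : List (Vect M)} → AddMulClosed (U ∩V W)
  ∩V-addMul-closed {U = U} {W} μ (u∈U , u∈W) (w∈U , w∈W) =
    ⟨⟩-addMul-closed {L = U} μ u∈U w∈U , ⟨⟩-addMul-closed {L = W} μ u∈W w∈W

  lincombL-vanish : ∀ {M} (L : List (Vect M)) ls y → All (λ v → v y ≈ 0#) L → lincombL L ls y ≈ 0#
  lincombL-vanish []      ls y []         = refl
  lincombL-vanish (v ∷ L) ls y (v≈0 ∷ L≈0) =
    trans (+-cong (*-congˡ v≈0) (lincombL-vanish L (ls ∘ suc) y L≈0)) (trans (+-identityʳ _) (zeroʳ _))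

  ⟨⟩-vanish : ∀ {M} (L : List (Vect M)) {v} y → All (λ u → u y ≈ 0#) L → ⟨ L ⟩ v → v y ≈ 0#
  ⟨⟩-vanish L y L≈0 (ls , v≈) = trans (v≈ y) (lincombL-vanish L ls y L≈0)

  reindex : ∀ {M n} → (Fin M → Maybe (Fin n)) → Vect n → Vect M
  reindex ρ v y = maybe′ v 0# (ρ y)

  ⟨⟩-reindex : ∀ {M n} (ρ : Fin M → Maybe (Fin n)) (L : List (Vect n)) (L′ : List (Vect M)) {v} →
    All (λ u → ⟨ L′ ⟩ (reindex ρ u)) L → ⟨ L ⟩ v → ⟨ L′ ⟩ (reindex ρ v)
  ⟨⟩-reindex ρ L L′ {v} gens (ls , v≈) = ⟨⟩-resp-≈V {L = L′} reindex-v≈ (reindex-lincombL L ls gens)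
    where
    reindex-v≈ : reindex ρ v ≈V reindex ρ (lincombL L ls)
    reindex-v≈ y with ρ y
    ... | just z  = v≈ z
    ... | nothing = refl
    reindex-zero : ∀ y → reindex ρ (λ _ → 0#) y ≈ 0#
    reindex-zero y with ρ y
    ... | just _  = refl
    ... | nothing = refl
    reindex-lincombL : ∀ K ks → All (λ u → ⟨ L′ ⟩ (reindex ρ u)) K → ⟨ L′ ⟩ (reindex ρ (lincombL K ks))
    reindex-lincombL []      ks []      = ⟨⟩-resp-≈V {L = L′} reindex-zero (⟨⟩-zeroV L′)
    reindex-lincombL (u ∷ K) ks (u∈ ∷ K∈) =
      ⟨⟩-resp-≈V {L = L′} unfold (⟨⟩-addMul-closed {L = L′} (ks zero) (reindex-lincombL K (ks ∘ suc) K∈) u∈)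
      where
      unfold : reindex ρ (lincombL (u ∷ K) ks) ≈V addMul (reindex ρ (lincombL K (ks ∘ suc))) (ks zero) (reindex ρ u)
      unfold y with ρ y
      ... | just _  = +-comm _ _
      ... | nothing = sym (trans (+-identityˡ _) (zeroʳ _))

  lincomb-pointwise : ∀ {M M′ k} (vs : Vec (Vect M) k) (ws : Vec (Vect M′) k) ls y z →
    (∀ t → lookup vs t y ≈ lookup ws t z) → lincomb vs ls y ≈ lincomb ws ls z
  lincomb-pointwise []       []       []       y z _  = refl
  lincomb-pointwise (v ∷ vs) (w ∷ ws) (l ∷ ls) y z eq =
    +-cong (*-congˡ (eq zero)) (lincomb-pointwise vs ws ls y z (eq ∘ suc))

  lincomb-vanish : ∀ {M k} (vs : Vec (Vect M) k) ls y → (∀ t → lookup vs t y ≈ 0#) → lincomb vs ls y ≈ 0#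
  lincomb-vanish []       []       y _   = refl
  lincomb-vanish (v ∷ vs) (l ∷ ls) y vs≈0 =
    trans (+-cong (*-congˡ (vs≈0 zero)) (lincomb-vanish vs ls y (vs≈0 ∘ suc))) (trans (+-identityʳ _) (zeroʳ _))

  LinIndep-single : ∀ {M} {v : Vect M} y → v y ≈ 1# → LinIndep (v ∷ [])
  LinIndep-single y v≈1 (l ∷ []) l·v≈0 zero =
    trans (sym (trans (+-cong (*-congˡ v≈1) refl) (trans (+-identityʳ _) (*-identityʳ l)))) (l·v≈0 y)

  DimLe-restrict : ∀ {M n c} (r : Fin n → Fin M) {P : VPred M} {Q : VPred n} →
    (∀ {v} → P v → Q (v ∘ r)) →
    (∀ y → (∃ λ z → r z ≡.≡ y) ⊎ (∀ {v} → P v → v y ≈ 0#)) →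
    DimLe Q c → DimLe P c
  DimLe-restrict r {P} {Q} P⇒Q covered dimQ k vs inP indep = dimQ k (map (_∘ r) vs) inQ indep′
    where
    inQ : ∀ j → Q (lookup (map (_∘ r) vs) j)
    inQ j = ≡.subst Q (≡.sym (lookup-map j (_∘ r) vs)) (P⇒Q (inP j))
    indep′ : LinIndep (map (_∘ r) vs)
    indep′ ls ls·vs≈0 = indep ls ls·vs≈0′
      where
      ls·vs≈0′ : lincomb vs ls ≈V zeroV
      ls·vs≈0′ y with covered y
      ... | inj₁ (z , ≡.refl) = trans (lincomb-pointwise vs (map (_∘ r) vs) ls (r z) z
                                  (λ t → reflexive (≡.sym (≡.cong (λ u → u z) (lookup-map t (_∘ r) vs))))) (ls·vs≈0 z)
      ... | inj₂ vanish = lincomb-vanish vs ls y (λ t → vanish (inP t))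

  DimGt-reindex : ∀ {M n c} (ρ : Fin M → Maybe (Fin n)) (r : Fin n → Fin M) →
    (∀ v z → reindex ρ v (r z) ≈ v z) →
    ∀ {X Y : Subspace n} (X′ Y′ : Subspace M) →
    (∀ {u} → u ∈ X → ⟨ X′ ⟩ (reindex ρ u)) → (∀ {u} → u ∈ Y → ⟨ Y′ ⟩ (reindex ρ u)) →
    DimGt (X ∩V Y) c → DimGt (X′ ∩V Y′) c
  DimGt-reindex ρ r section {X} {Y} X′ Y′ X⊆ Y⊆ (vs , in∩ , indep) = map (reindex ρ) vs , in∩′ , indep′
    where
    in∩′ : ∀ j → (X′ ∩V Y′) (lookup (map (reindex ρ) vs) j)
    in∩′ j = ≡.subst (X′ ∩V Y′) (≡.sym (lookup-map j (reindex ρ) vs))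
      (⟨⟩-reindex ρ X X′ (tabulate X⊆) (proj₁ (in∩ j)) , ⟨⟩-reindex ρ Y Y′ (tabulate Y⊆) (proj₂ (in∩ j)))
    indep′ : LinIndep (map (reindex ρ) vs)
    indep′ ls ls·vs≈0 = indep ls (λ z → trans (lincomb-pointwise vs (map (reindex ρ) vs) ls z (r z)
      (λ t → sym (trans (reflexive (≡.cong (λ u → u (r z)) (lookup-map t (reindex ρ) vs))) (section _ z)))) (ls·vs≈0 (r z)))

  ¬¬-∀-Fin : ∀ {k p} {Q : Fin k → Set p} → (∀ t → ¬ ¬ Q t) → ¬ ¬ (∀ t → Q t)
  ¬¬-∀-Fin {zero}  _   ¬all = ¬all (λ ())
  ¬¬-∀-Fin {suc k} ¬¬Q ¬all =
    ¬¬Q zero (λ q₀ → ¬¬-∀-Fin (¬¬Q ∘ suc) (λ qs → ¬all (λ { zero → q₀ ; (suc t) → qs t })))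

  lookup-removeAt : ∀ {a} {A : Set a} {k} (xs : Vec A (suc k)) t s →
                    lookup (removeAt xs t) s ≡.≡ lookup xs (punchIn t s)
  lookup-removeAt (x ∷ xs)     zero    s       = ≡.refl
  lookup-removeAt (x ∷ y ∷ xs) (suc t) zero    = ≡.refl
  lookup-removeAt (x ∷ y ∷ xs) (suc t) (suc s) = lookup-removeAt (y ∷ xs) t s

  lincomb-insertAt : ∀ {M k} (vs : Vec (Vect M) (suc k)) t ls μ y →
    lincomb vs (insertAt ls t μ) y ≈ lincomb (removeAt vs t) ls y + μ * lookup vs t y
  lincomb-insertAt (v ∷ vs)     zero    ls       μ y = +-comm _ _
  lincomb-insertAt (v ∷ v′ ∷ vs) (suc t) (l ∷ ls) μ y =
    trans (+-cong refl (lincomb-insertAt (v′ ∷ vs) t ls μ y)) (sym (+-assoc _ _ _))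

  coeffSum : ∀ {M k} → (Vect M → Carrier) → Vec (Vect M) k → Vec Carrier k → Carrier
  coeffSum c []       []       = 0#
  coeffSum c (u ∷ us) (l ∷ ls) = l * c u + coeffSum c us ls

  lincomb-map-addMul : ∀ {M k} (c : Vect M → Carrier) (w : Vect M) (us : Vec (Vect M) k) ls y →
    lincomb (map (λ u → addMul u (c u) w) us) ls y ≈ lincomb us ls y + coeffSum c us ls * w y
  lincomb-map-addMul c w []       []       y = sym (trans (+-identityˡ _) (zeroˡ _))
  lincomb-map-addMul c w (u ∷ us) (l ∷ ls) y =
    trans (+-cong refl (lincomb-map-addMul c w us ls y)) (regroup l (u y) (w y) (c u) _ _)
    where
    regroup : ∀ l u w c S R → l * (u + c * w) + (R + S * w) ≈ (l * u + R) + (l * c + S) * w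
    regroup = solve 6 (λ l u w c S R → l :* (u :+ c :* w) :+ (R :+ S :* w) := (l :* u :+ R) :+ (l :* c :+ S) :* w) refl

  eliminate-pivot : ∀ {M k} {P : VPred M} (x : Fin M) → AddMulClosed P →
    (vs : Vec (Vect M) (suc k)) → (∀ j → P (lookup vs j)) → LinIndep vs →
    ∀ t → ¬ (lookup vs t x ≈ 0#) →
    Σ (Vec (Vect M) k) λ ws → (∀ s → P (lookup ws s) × lookup ws s x ≈ 0#) × LinIndep ws
  eliminate-pivot {M} {k} {P} x closed vs inP indep t wx≉0 = map clear others , inSection , indep′
    where
    w : Vect M
    w = lookup vs t
    α : Carrier
    α = proj₁ (inverse (w x) wx≉0)
    coeff : Vect M → Carrier
    coeff u = - (u x * α)
    clear : Vect M → Vect M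
    clear u = addMul u (coeff u) w
    others : Vec (Vect M) k
    others = removeAt vs t

    clear-x : ∀ u → clear u x ≈ 0#
    clear-x u = begin
      u x + - (u x * α) * w x ≈⟨ +-cong refl (sym (-‿distribˡ-* (u x * α) (w x))) ⟩
      u x + - (u x * α * w x) ≈⟨ +-cong refl (-‿cong (trans (reassoc (u x) α (w x)) (*-congˡ (proj₂ (inverse (w x) wx≉0))))) ⟩
      u x + - (u x * 1#)      ≈⟨ +-cong refl (-‿cong (*-identityʳ (u x))) ⟩
      u x + - u x             ≈⟨ -‿inverseʳ (u x) ⟩
      0#                      ∎
      where
      open import Relation.Binary.Reasoning.Setoid setoid
      reassoc : ∀ a b c → a * b * c ≈ a * (c * b)
      reassoc = solve 3 (λ a b c → a :* b :* c := a :* (c :* b)) refl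

    inSection : ∀ s → P (lookup (map clear others) s) × lookup (map clear others) s x ≈ 0#
    inSection s = ≡.subst (λ u → P u × u x ≈ 0#) (≡.sym (lookup-map s clear others))
      (closed (coeff (lookup others s)) inOthers (inP t) , clear-x (lookup others s))
      where
      inOthers : P (lookup others s)
      inOthers = ≡.subst P (≡.sym (lookup-removeAt vs t s)) (inP (punchIn t s))

    indep′ : LinIndep (map clear others)
    indep′ ls ls·ws≈0 s = ≡.subst (_≈ 0#) (insertAt-punchIn ls t μ s) (indep (insertAt ls t μ) ls·vs≈0 (punchIn t s))
      where
      μ = coeffSum coeff others ls
      ls·vs≈0 : lincomb vs (insertAt ls t μ) ≈V zeroV
      ls·vs≈0 y = trans (lincomb-insertAt vs t ls μ y) (trans (sym (lincomb-map-addMul coeff w others ls y)) (ls·ws≈0 y))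

  DimLe-suc-hyperplane : ∀ {M n} (P : VPred M) (x : Fin M) → AddMulClosed P →
              DimLe (λ v → P v × v x ≈ 0#) n → DimLe P (suc n)
  DimLe-suc-hyperplane P x closed dim zero    vs inP indep = z≤n
  DimLe-suc-hyperplane {n = n} P x closed dim (suc k) vs inP indep =
    decidable-stable (suc k ≤? suc n) λ k≰n → ¬¬-excluded-middle (bound k≰n)
    where
    -- Equality in F is not decidable, so the search for a pivot runs under a double
    -- negation, which the decidable conclusion absorbs.
    bound : ¬ suc k ≤ suc n → Dec (∃ λ t → ¬ (lookup vs t x ≈ 0#)) → ⊥
    bound k≰n (yes (t , wx≉0)) with eliminate-pivot {P = P} x closed vs inP indep t wx≉0
    ... | ws , inSection , indep′ = k≰n (s≤s (dim k ws inSection indep′))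
    bound k≰n (no ¬eliminate-pivot) =
      ¬¬-∀-Fin (λ t wx≉0 → ¬eliminate-pivot (t , wx≉0))
               (λ vs-x≈0 → k≰n (m≤n⇒m≤1+n (dim (suc k) vs (λ j → inP j , vs-x≈0 j) indep)))

module VecSystems {f ℓ} (F : Field f ℓ) where

  open Indexing
  open Linear F
  open import Data.Nat using (ℕ; suc; _≤_) renaming (_+_ to _+ℕ_)
  open import Data.Nat.Properties using (≤-trans)
  open import Data.Fin using (Fin; zero; suc; _↑ˡ_; _↑ʳ_) renaming (_<_ to _<ᶠ_)
  open import Data.Maybe using (Maybe; just; nothing; maybe′)
  open import Data.Vec using ([]; _∷_)
  open import Data.List using (_∷_; map)
  open import Data.List.Membership.Propositional using (_∈_)
  open import Data.List.Membership.Propositional.Properties using (∈-map⁺)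
  open import Data.List.Relation.Unary.All using (All; _∷_; tabulate; universal)
  open import Data.List.Relation.Unary.All.Properties using (map⁺)
  open import Data.List.Relation.Unary.Any using (here; there)
  open import Data.Product using (∃; _×_; _,_; proj₁; proj₂)
  open import Data.Sum using (_⊎_; inj₁; inj₂)
  open import Data.Empty using (⊥-elim)
  open import Function using (_∘_; const)
  open import Relation.Binary.PropositionalEquality as ≡ using (_≡_)

  open Field F hiding (zero)
  open VS F

  HasModVecSystem-mono : ∀ {p q p′ q′ m} → p ≤ p′ → q ≤ q′ →
                         HasModVecSystem p q 0 m → HasModVecSystem p′ q′ 0 m
  HasModVecSystem-mono p≤ q≤ (N , A , B , earlier , small , disjoint , meets) =
    N , A , B , (λ i k vs inP indep → ≤-trans (earlier i k vs inP indep) p≤)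
              , (λ i k vs inP indep → ≤-trans (small i k vs inP indep) q≤) , disjoint , meets

  module Coordinates (N₁ N₂ : ℕ) where

    open Blocks N₁ N₂

    N : ℕ
    N = suc (N₁ +ℕ N₂)

    ι₁ : Fin N₁ → Fin N
    ι₁ i = suc (i ↑ˡ N₂)

    ι₂ : Fin N₂ → Fin N
    ι₂ j = suc (N₁ ↑ʳ j)

    data Coordinate : Fin N → Set where
      fresh  : Coordinate zero
      first  : ∀ i → Coordinate (ι₁ i)
      second : ∀ j → Coordinate (ι₂ j)

    coordinate : ∀ y → Coordinate y
    coordinate zero = fresh
    coordinate (suc y) with block y
    ... | left i  = first i
    ... | right j = second j

    ρ₁ : Fin N → Maybe (Fin N₁)
    ρ₁ zero    = nothing
    ρ₁ (suc y) = glue just (const nothing) y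

    ρ₂ : Fin N → Maybe (Fin N₂)
    ρ₂ zero    = nothing
    ρ₂ (suc y) = glue (const nothing) just y

    emb₁ : Vect N₁ → Vect N
    emb₁ = reindex ρ₁

    emb₂ : Vect N₂ → Vect N
    emb₂ = reindex ρ₂

    e₀ : Vect N
    e₀ zero    = 1#
    e₀ (suc _) = 0#

    emb₁-ι₁ : ∀ a i → emb₁ a (ι₁ i) ≈ a i
    emb₁-ι₁ a i = reflexive (≡.cong (maybe′ a 0#) (glue-↑ˡ just (const nothing) i))

    emb₁-ι₂ : ∀ a j → emb₁ a (ι₂ j) ≈ 0#
    emb₁-ι₂ a j = reflexive (≡.cong (maybe′ a 0#) (glue-↑ʳ just (const nothing) j))

    emb₂-ι₁ : ∀ a i → emb₂ a (ι₁ i) ≈ 0#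
    emb₂-ι₁ a i = reflexive (≡.cong (maybe′ a 0#) (glue-↑ˡ (const nothing) just i))

    emb₂-ι₂ : ∀ a j → emb₂ a (ι₂ j) ≈ a j
    emb₂-ι₂ a j = reflexive (≡.cong (maybe′ a 0#) (glue-↑ʳ (const nothing) just j))

    DimLe-first : ∀ {c} {P : VPred N} {Q : VPred N₁} → (∀ {v} → P v → Q (v ∘ ι₁)) →
      (∀ {v} → P v → v zero ≈ 0#) → (∀ {v} → P v → ∀ j → v (ι₂ j) ≈ 0#) → DimLe Q c → DimLe P c
    DimLe-first {P = P} {Q} P⇒Q at₀ at₂ = DimLe-restrict ι₁ {Q = Q} P⇒Q covered
      where
      covered : ∀ y → (∃ λ i → ι₁ i ≡ y) ⊎ (∀ {v} → P v → v y ≈ 0#)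
      covered y with coordinate y
      ... | fresh    = inj₂ (λ {v} → at₀ {v})
      ... | first i  = inj₁ (i , ≡.refl)
      ... | second j = inj₂ (λ {v} Pv → at₂ Pv j)

    DimLe-second : ∀ {c} {P : VPred N} {Q : VPred N₂} → (∀ {v} → P v → Q (v ∘ ι₂)) →
      (∀ {v} → P v → v zero ≈ 0#) → (∀ {v} → P v → ∀ i → v (ι₁ i) ≈ 0#) → DimLe Q c → DimLe P c
    DimLe-second {P = P} {Q} P⇒Q at₀ at₁ = DimLe-restrict ι₂ {Q = Q} P⇒Q covered
      where
      covered : ∀ y → (∃ λ j → ι₂ j ≡ y) ⊎ (∀ {v} → P v → v y ≈ 0#)
      covered y with coordinate y
      ... | fresh    = inj₂ (λ {v} → at₀ {v})
      ... | first i  = inj₂ (λ {v} Pv → at₁ Pv i)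
      ... | second j = inj₁ (j , ≡.refl)

    restrict-⟨⟩ : ∀ {n} (ι : Fin n → Fin N) (X : Subspace n) (L : Subspace N) {v} →
                  All (λ u → ⟨ X ⟩ (u ∘ ι)) L → ⟨ L ⟩ v → ⟨ X ⟩ (v ∘ ι)
    restrict-⟨⟩ ι X L = ⟨⟩-reindex (just ∘ ι) L X

    e₀-restrict₁ : ∀ (X : Subspace N₁) → ⟨ X ⟩ (e₀ ∘ ι₁)
    e₀-restrict₁ = ⟨⟩-zeroV

    e₀-restrict₂ : ∀ (X : Subspace N₂) → ⟨ X ⟩ (e₀ ∘ ι₂)
    e₀-restrict₂ = ⟨⟩-zeroV

    emb₁-restrict₁ : ∀ (X : Subspace N₁) Y → (∀ {a} → a ∈ Y → ⟨ X ⟩ a) → All (λ u → ⟨ X ⟩ (u ∘ ι₁)) (map emb₁ Y)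
    emb₁-restrict₁ X Y Y⊆X = map⁺ (tabulate (λ a∈ → ⟨⟩-resp-≈V {L = X} (emb₁-ι₁ _) (Y⊆X a∈)))

    emb₂-restrict₂ : ∀ (X : Subspace N₂) Y → (∀ {a} → a ∈ Y → ⟨ X ⟩ a) → All (λ u → ⟨ X ⟩ (u ∘ ι₂)) (map emb₂ Y)
    emb₂-restrict₂ X Y Y⊆X = map⁺ (tabulate (λ a∈ → ⟨⟩-resp-≈V {L = X} (emb₂-ι₂ _) (Y⊆X a∈)))

    emb₁-restrict₂ : ∀ (X : Subspace N₂) Y → All (λ u → ⟨ X ⟩ (u ∘ ι₂)) (map emb₁ Y)
    emb₁-restrict₂ X = map⁺ ∘ universal (λ a → ⟨⟩-resp-≈V {L = X} (emb₁-ι₂ a) (⟨⟩-zeroV X))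

    emb₁-vanish₀ : ∀ Y → All (λ u → u zero ≈ 0#) (map emb₁ Y)
    emb₁-vanish₀ = map⁺ ∘ universal (λ _ → refl)

    emb₂-vanish₀ : ∀ Y → All (λ u → u zero ≈ 0#) (map emb₂ Y)
    emb₂-vanish₀ = map⁺ ∘ universal (λ _ → refl)

    emb₁-vanish₂ : ∀ Y j → All (λ u → u (ι₂ j) ≈ 0#) (map emb₁ Y)
    emb₁-vanish₂ Y j = map⁺ (universal (λ a → emb₁-ι₂ a j) Y)

    emb₂-vanish₁ : ∀ Y i → All (λ u → u (ι₁ i) ≈ 0#) (map emb₂ Y)
    emb₂-vanish₁ Y i = map⁺ (universal (λ a → emb₂-ι₁ a i) Y)

  module Merge {p q m₁ m₂ N₁ N₂} (A₁ B₁ : Fin m₁ → Subspace N₁) (A₂ B₂ : Fin m₂ → Subspace N₂)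
    (S₁ : IsModVecSystem p (suc q) 0 A₁ B₁) (S₂ : IsModVecSystem (suc p) q 0 A₂ B₂) where

    open Blocks m₁ m₂
    open Coordinates N₁ N₂

    A₁′ B₁′ : Fin m₁ → Subspace N
    A₁′ i = e₀ ∷ map emb₁ (A₁ i)
    B₁′ i = map emb₁ (B₁ i)

    A₂′ B₂′ : Fin m₂ → Subspace N
    A₂′ j = map emb₂ (A₂ j)
    B₂′ j = e₀ ∷ map emb₂ (B₂ j)

    A B : Fin (m₁ +ℕ m₂) → Subspace N
    A = glue A₁′ A₂′
    B = glue B₁′ B₂′

    earlier-first : ∀ i → All (λ u → ⟨ sumBefore A₁ i ⟩ (u ∘ ι₁)) (sumBefore A (i ↑ˡ m₂))
    earlier-first i = All-concat-before A (i ↑ˡ m₂) gens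
      where
      gens : ∀ k′ → k′ <ᶠ i ↑ˡ m₂ → All (λ u → ⟨ sumBefore A₁ i ⟩ (u ∘ ι₁)) (A k′)
      gens k′ lt with block k′
      ... | left i′  = ≡.subst (All _) (≡.sym (glue-↑ˡ A₁′ A₂′ i′))
                         (e₀-restrict₁ (sumBefore A₁ i) ∷ emb₁-restrict₁ (sumBefore A₁ i) (A₁ i′)
                           (λ a∈ → ⟨⟩-∈ (∈-concat-before A₁ (↑ˡ-<-cancel lt) a∈)))
      ... | right j′ = ⊥-elim (↑ʳ≮↑ˡ lt)

    earlier-second : ∀ j → All (λ u → ⟨ sumBefore A₂ j ⟩ (u ∘ ι₂)) (sumBefore A (m₁ ↑ʳ j))
    earlier-second j = All-concat-before A (m₁ ↑ʳ j) gens
      where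
      gens : ∀ k′ → k′ <ᶠ m₁ ↑ʳ j → All (λ u → ⟨ sumBefore A₂ j ⟩ (u ∘ ι₂)) (A k′)
      gens k′ lt with block k′
      ... | left i′  = ≡.subst (All _) (≡.sym (glue-↑ˡ A₁′ A₂′ i′))
                         (e₀-restrict₂ (sumBefore A₂ j) ∷ emb₁-restrict₂ (sumBefore A₂ j) (A₁ i′))
      ... | right j′ = ≡.subst (All _) (≡.sym (glue-↑ʳ A₁′ A₂′ j′))
                         (emb₂-restrict₂ (sumBefore A₂ j) (A₂ j′) (λ a∈ → ⟨⟩-∈ (∈-concat-before A₂ (↑ʳ-<-cancel lt) a∈)))

    A∩earlier : ∀ k → DimLe (A k ∩V sumBefore A k) (suc p)
    A∩earlier = glue-elim (λ k X → DimLe (X ∩V sumBefore A k) (suc p)) first-bound second-bound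
      where
      first-bound : ∀ i → DimLe (A₁′ i ∩V sumBefore A (i ↑ˡ m₂)) (suc p)
      first-bound i =
        DimLe-suc-hyperplane (A₁′ i ∩V sumBefore A (i ↑ˡ m₂)) zero
          (∩V-addMul-closed {U = A₁′ i} {W = sumBefore A (i ↑ˡ m₂)})
          (DimLe-first {P = P} {A₁ i ∩V sumBefore A₁ i} into proj₂ at₂ (proj₁ S₁ i))
        where
        P : VPred N
        P v = (A₁′ i ∩V sumBefore A (i ↑ˡ m₂)) v × v zero ≈ 0#
        into : ∀ {v} → P v → (A₁ i ∩V sumBefore A₁ i) (v ∘ ι₁)
        into ((a , s) , _) = restrict-⟨⟩ ι₁ (A₁ i) (A₁′ i) (e₀-restrict₁ (A₁ i) ∷ emb₁-restrict₁ (A₁ i) (A₁ i) (⟨⟩-∈ {L = A₁ i})) a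
                           , restrict-⟨⟩ ι₁ (sumBefore A₁ i) (sumBefore A (i ↑ˡ m₂)) (earlier-first i) s
        at₂ : ∀ {v} → P v → ∀ j → v (ι₂ j) ≈ 0#
        at₂ ((a , _) , _) j = ⟨⟩-vanish (A₁′ i) (ι₂ j) (refl ∷ emb₁-vanish₂ (A₁ i) j) a
      second-bound : ∀ j → DimLe (A₂′ j ∩V sumBefore A (m₁ ↑ʳ j)) (suc p)
      second-bound j = DimLe-second {P = P} {A₂ j ∩V sumBefore A₂ j} into at₀ at₁ (proj₁ S₂ j)
        where
        P : VPred N
        P = A₂′ j ∩V sumBefore A (m₁ ↑ʳ j)
        into : ∀ {v} → P v → (A₂ j ∩V sumBefore A₂ j) (v ∘ ι₂)
        into (a , s) = restrict-⟨⟩ ι₂ (A₂ j) (A₂′ j) (emb₂-restrict₂ (A₂ j) (A₂ j) (⟨⟩-∈ {L = A₂ j})) a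
                     , restrict-⟨⟩ ι₂ (sumBefore A₂ j) (sumBefore A (m₁ ↑ʳ j)) (earlier-second j) s
        at₀ : ∀ {v} → P v → v zero ≈ 0#
        at₀ (a , _) = ⟨⟩-vanish (A₂′ j) zero (emb₂-vanish₀ (A₂ j)) a
        at₁ : ∀ {v} → P v → ∀ i → v (ι₁ i) ≈ 0#
        at₁ (a , _) i = ⟨⟩-vanish (A₂′ j) (ι₁ i) (emb₂-vanish₁ (A₂ j) i) a

    B-small : ∀ k → DimLe ⟨ B k ⟩ (suc q)
    B-small = glue-elim (λ _ X → DimLe ⟨ X ⟩ (suc q)) first-bound second-bound
      where
      first-bound : ∀ i → DimLe ⟨ B₁′ i ⟩ (suc q)
      first-bound i = DimLe-first {P = ⟨ B₁′ i ⟩} {⟨ B₁ i ⟩}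
        (restrict-⟨⟩ ι₁ (B₁ i) (B₁′ i) (emb₁-restrict₁ (B₁ i) (B₁ i) (⟨⟩-∈ {L = B₁ i})))
        (⟨⟩-vanish (B₁′ i) zero (emb₁-vanish₀ (B₁ i)))
        (λ b j → ⟨⟩-vanish (B₁′ i) (ι₂ j) (emb₁-vanish₂ (B₁ i) j) b)
        (proj₁ (proj₂ S₁) i)
      second-bound : ∀ j → DimLe ⟨ B₂′ j ⟩ (suc q)
      second-bound j = DimLe-suc-hyperplane ⟨ B₂′ j ⟩ zero (⟨⟩-addMul-closed {L = B₂′ j})
        (DimLe-second {P = λ v → ⟨ B₂′ j ⟩ v × v zero ≈ 0#} {⟨ B₂ j ⟩}
          (λ (b , _) → restrict-⟨⟩ ι₂ (B₂ j) (B₂′ j) (e₀-restrict₂ (B₂ j) ∷ emb₂-restrict₂ (B₂ j) (B₂ j) (⟨⟩-∈ {L = B₂ j})) b)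
          proj₂
          (λ (b , _) i → ⟨⟩-vanish (B₂′ j) (ι₁ i) (refl ∷ emb₂-vanish₁ (B₂ j) i) b)
          (proj₁ (proj₂ S₂) j))

    A∩B-trivial : ∀ k → DimLe (A k ∩V B k) 0
    A∩B-trivial = glue-elim₂ (λ _ X Y → DimLe (X ∩V Y) 0) first-bound second-bound
      where
      first-bound : ∀ i → DimLe (A₁′ i ∩V B₁′ i) 0
      first-bound i = DimLe-first {P = A₁′ i ∩V B₁′ i} {A₁ i ∩V B₁ i}
        (λ (a , b) → restrict-⟨⟩ ι₁ (A₁ i) (A₁′ i) (e₀-restrict₁ (A₁ i) ∷ emb₁-restrict₁ (A₁ i) (A₁ i) (⟨⟩-∈ {L = A₁ i})) a
                   , restrict-⟨⟩ ι₁ (B₁ i) (B₁′ i) (emb₁-restrict₁ (B₁ i) (B₁ i) (⟨⟩-∈ {L = B₁ i})) b)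
        (λ (_ , b) → ⟨⟩-vanish (B₁′ i) zero (emb₁-vanish₀ (B₁ i)) b)
        (λ (_ , b) j → ⟨⟩-vanish (B₁′ i) (ι₂ j) (emb₁-vanish₂ (B₁ i) j) b)
        (proj₁ (proj₂ (proj₂ S₁)) i)
      second-bound : ∀ j → DimLe (A₂′ j ∩V B₂′ j) 0
      second-bound j = DimLe-second {P = A₂′ j ∩V B₂′ j} {A₂ j ∩V B₂ j}
        (λ (a , b) → restrict-⟨⟩ ι₂ (A₂ j) (A₂′ j) (emb₂-restrict₂ (A₂ j) (A₂ j) (⟨⟩-∈ {L = A₂ j})) a
                   , restrict-⟨⟩ ι₂ (B₂ j) (B₂′ j) (e₀-restrict₂ (B₂ j) ∷ emb₂-restrict₂ (B₂ j) (B₂ j) (⟨⟩-∈ {L = B₂ j})) b)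
        (λ (a , _) → ⟨⟩-vanish (A₂′ j) zero (emb₂-vanish₀ (A₂ j)) a)
        (λ (a , _) i → ⟨⟩-vanish (A₂′ j) (ι₁ i) (emb₂-vanish₁ (A₂ j) i) a)
        (proj₁ (proj₂ (proj₂ S₂)) j)

    A∩later-B : ∀ k k′ → k <ᶠ k′ → DimGt (A k ∩V B k′) 0
    A∩later-B k k′ lt with block k | block k′
    ... | left i | left i′ = ≡.subst₂ (λ X Y → DimGt (X ∩V Y) 0) (≡.sym (glue-↑ˡ A₁′ A₂′ i)) (≡.sym (glue-↑ˡ B₁′ B₂′ i′))
      (DimGt-reindex ρ₁ ι₁ emb₁-ι₁ (A₁′ i) (B₁′ i′)
        (λ a∈ → ⟨⟩-∈ {L = A₁′ i} (there (∈-map⁺ emb₁ a∈))) (λ b∈ → ⟨⟩-∈ {L = B₁′ i′} (∈-map⁺ emb₁ b∈))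
        (proj₂ (proj₂ (proj₂ S₁)) i i′ (↑ˡ-<-cancel lt)))
    ... | left i | right j′ = ≡.subst₂ (λ X Y → DimGt (X ∩V Y) 0) (≡.sym (glue-↑ˡ A₁′ A₂′ i)) (≡.sym (glue-↑ʳ B₁′ B₂′ j′))
      (e₀ ∷ [] , (λ { zero → ⟨⟩-∈ {L = A₁′ i} (here ≡.refl) , ⟨⟩-∈ {L = B₂′ j′} (here ≡.refl) }) , LinIndep-single zero refl)
    ... | right j | left i′ = ⊥-elim (↑ʳ≮↑ˡ lt)
    ... | right j | right j′ = ≡.subst₂ (λ X Y → DimGt (X ∩V Y) 0) (≡.sym (glue-↑ʳ A₁′ A₂′ j)) (≡.sym (glue-↑ʳ B₁′ B₂′ j′))
      (DimGt-reindex ρ₂ ι₂ emb₂-ι₂ (A₂′ j) (B₂′ j′)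
        (λ a∈ → ⟨⟩-∈ {L = A₂′ j} (∈-map⁺ emb₂ a∈)) (λ b∈ → ⟨⟩-∈ {L = B₂′ j′} (there (∈-map⁺ emb₂ b∈)))
        (proj₂ (proj₂ (proj₂ S₂)) j j′ (↑ʳ-<-cancel lt)))

    isModVecSystem : IsModVecSystem (suc p) (suc q) 0 A B
    isModVecSystem = A∩earlier , B-small , A∩B-trivial , A∩later-B

  merge : ∀ {p q m₁ m₂} → HasModVecSystem p (suc q) 0 m₁ → HasModVecSystem (suc p) q 0 m₂ →
          HasModVecSystem (suc p) (suc q) 0 (m₁ +ℕ m₂)
  merge (N₁ , A₁ , B₁ , S₁) (N₂ , A₂ , B₂ , S₂) = suc (N₁ +ℕ N₂) , A , B , isModVecSystem
    where open Merge A₁ B₁ A₂ B₂ S₁ S₂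

open import Data.Nat using (ℕ; _+_; _*_)
open import Data.Nat.Combinatorics using (_C_)
open import Data.Product using (_×_; _,_)
open Amplification using (binomial-amplify)

lemma10 : ∀ {f ℓ : Level} (F : Field f ℓ) → Infinite F →
    ∀ (a b c d m : ℕ) →
      (HasModSetSystem c d 0 m →
        HasModSetSystem (a + c) (b + d) 0 (((a + b) C a) * m))
      × (VS.HasModVecSystem F c d 0 m →
        VS.HasModVecSystem F (a + c) (b + d) 0 (((a + b) C a) * m))
lemma10 F _ a b c d m =
    binomial-amplify (λ p q k → HasModSetSystem p q 0 k)
      SetSystems.HasModSetSystem-mono SetSystems.merge a b
  , binomial-amplify (λ p q k → VS.HasModVecSystem F p q 0 k)
      (VecSystems.HasModVecSystem-mono F) (VecSystems.merge F) a b
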